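{- Let $m, n$ be integers with $m, n \geq 3$. Then $F(C_m \cdot C_n) \geq nm - n + \left\lfloor \frac{n}{2} \right\rfloor$.
   Context: All graphs are simple, finite and undirected; $C_k$ is the cycle on $k$ vertices. The lexicographic product $G \cdot H$ has vertex set $V(G)\times V(H)$, with $(u,v)$ adjacent to $(u',v')$ iff $uu'\in E(G)$, or ($u=u'$ and $vv'\in E(H)$). Zero forcing: each vertex is blue or white; starting from an initial set $S$ of blue vertices, repeatedly apply the color-change rule: if a blue vertex $u$ has exactly one white neighbor $v$, color $v$ blue. $S$ is a zero forcing set if eventually all vertices are blue, and a failed zero forcing set otherwise. $F(G)$ denotes the maximum cardinality of a failed zero forcing set of $G$. -}

module Defs where

open import Data.Nat using (ℕ; suc; _+_; _∸_)
open import Data.Nat.ListAction using (sum)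
open import Data.Fin using (Fin; toℕ)
open import Data.Bool using (Bool; true; false; if_then_else_)
open import Data.List using (map; allFin)
open import Data.Product using (_×_; _,_)
open import Data.Sum using (_⊎_)
open import Relation.Binary.PropositionalEquality using (_≡_; _≢_)
open import Relation.Nullary using (¬_)

record Graph : Set₁ where
  field
    V   : Set
    Adj : V → V → Set

open Graph public

-- Cycle C_k on vertex set Fin k = {0,…,k-1}: i ~ j iff j ≡ i+1 (mod k) or i ≡ j+1 (mod k),
-- i.e. consecutive integers, plus the edge {k-1, 0}.
-- (For k ≥ 3 this is the simple cycle on k vertices.)
Succ : (k : ℕ) → Fin k → Fin k → Set
Succ k i j = (toℕ j ≡ suc (toℕ i)) ⊎ ((toℕ i ≡ k ∸ 1) × (toℕ j ≡ 0))

CycleAdj : (k : ℕ) → Fin k → Fin k → Set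
CycleAdj k i j = Succ k i j ⊎ Succ k j i

Cycle : (k : ℕ) → Graph
Cycle k = record { V = Fin k ; Adj = CycleAdj k }

Lex : Graph → Graph → Graph
Lex G H = record
  { V   = V G × V H
  ; Adj = λ { (u , v) (u' , v') → Adj G u u' ⊎ (u ≡ u' × Adj H v v') }
  }

-- Vertices coloured blue by the zero forcing process started from S
-- (the final colouring: least set containing S closed under the colour-change rule).
data Blue (G : Graph) (S : V G → Bool) : V G → Set where
  init  : ∀ {v} → S v ≡ true → Blue G S v
  force : ∀ {u v} → Adj G u v → Blue G S u →
          (∀ w → Adj G u w → w ≢ v → Blue G S w) → Blue G S v

ZeroForcingSet : (G : Graph) → (V G → Bool) → Set
ZeroForcingSet G S = ∀ v → Blue G S v

FailedZeroForcingSet : (G : Graph) → (V G → Bool) → Set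
FailedZeroForcingSet G S = ¬ ZeroForcingSet G S

card : (m n : ℕ) → (Fin m × Fin n → Bool) → ℕ
card m n S = sum (map (λ i → sum (map (λ j → if S (i , j) then 1 else 0) (allFin n))) (allFin m))

-- The complement W of the initial blue set is a fort: every vertex outside W that has a
-- neighbour in W has at least two, so no vertex can ever force into W and W stays white.
-- In C_m · C_n take W = {0} × (even vertices of C_n): the even vertices form a fort of C_n
-- with at least two elements, and a vertex of C_m adjacent to 0 sees all of {0} × C_n.
-- The blue set then misses only the ⌈n/2⌉ even vertices of one copy of C_n.
module Submission where

open import Defs
open import Data.Nat using (ℕ; zero; suc; _+_; _*_; _∸_; _/_; _≤_; z≤n; s≤s; ⌊_/2⌋)
open import Data.Nat.Properties
  using (suc-injective; <-asym; ≤-reflexive; *-comm; *-suc; *-identityʳ; m+n∸m≡n; +-comm)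
open import Data.Nat.DivMod using (m/n≡1+[m∸n]/n)
open import Data.Nat.ListAction using (sum)
open import Data.Fin using (Fin; toℕ; inject₁) renaming (zero to fzero; suc to fsuc)
open import Data.Fin.Properties using (toℕ-inject₁; toℕ-fromℕ) renaming (_≟_ to _≟ᶠ_)
open import Data.Fin.Relation.Unary.Top using (view; ‵fromℕ; ‵inject₁)
open import Data.Bool using (Bool; true; false; not; if_then_else_)
open import Data.Bool.Properties using (¬-not; not-injective)
open import Data.List using (map; allFin)
open import Data.List.Properties using (map-tabulate)
open import Data.Product using (Σ; ∃-syntax; _×_; _,_; proj₁; proj₂)
open import Data.Sum using (inj₁; inj₂)
open import Function using (_∘_)
open import Relation.Nullary using (¬_; yes; no)
open import Relation.Binary.PropositionalEquality

private
  variable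
    k m n : ℕ

IsFort : (G : Graph) → (V G → Set) → Set
IsFort G W = ∀ {u v} → Adj G u v → ¬ W u → W v → ∃[ w ] Adj G u w × w ≢ v × W w

module _ {G : Graph} {S : V G → Bool} {W : V G → Set}
         (fort : IsFort G W) (disjoint : ∀ {v} → S v ≡ true → ¬ W v) where

  Blue⇒∉fort : ∀ {v} → Blue G S v → ¬ W v
  Blue⇒∉fort (init Sv) = disjoint Sv
  Blue⇒∉fort (force u~v blue-u others-blue) v∈W
    with fort u~v (Blue⇒∉fort blue-u) v∈W
  ... | w , u~w , w≢v , w∈W = Blue⇒∉fort (others-blue w u~w w≢v) w∈W

  fort⇒failed : ∀ {v} → W v → FailedZeroForcingSet G S
  fort⇒failed v∈W all-blue = Blue⇒∉fort (all-blue _) v∈W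

Lex-fort : ∀ {G H : Graph} {T : V H → Set} (x : V G) → IsFort H T →
           (∀ {c} → T c → ∃[ c′ ] T c′ × c′ ≢ c) →
           IsFort (Lex G H) (λ v → proj₁ v ≡ x × T (proj₂ v))
Lex-fort x fort other (inj₁ a~a′) _ (a′≡x , c∈T) with other c∈T
... | c′ , c′∈T , c′≢c = _ , inj₁ a~a′ , c′≢c ∘ cong proj₂ , a′≡x , c′∈T
Lex-fort x fort other (inj₂ (refl , b~c)) u∉W (a≡x , c∈T)
  with fort b~c (λ b∈T → u∉W (a≡x , b∈T)) c∈T
... | c′ , b~c′ , c′≢c , c′∈T =
  _ , inj₂ (refl , b~c′) , c′≢c ∘ cong proj₂ , a≡x , c′∈T

odd : ℕ → Bool
odd zero          = false
odd (suc zero)    = true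
odd (suc (suc k)) = odd k

odd-suc : ∀ k → odd (suc k) ≡ not (odd k)
odd-suc zero          = refl
odd-suc (suc zero)    = refl
odd-suc (suc (suc k)) = odd-suc k

Even : Fin n → Set
Even j = odd (toℕ j) ≡ false

Succ-asym : 3 ≤ n → {i j : Fin n} → Succ n i j → ¬ Succ n j i
Succ-asym _ (inj₁ j≡1+i) (inj₁ i≡1+j) =
  <-asym (≤-reflexive (sym i≡1+j)) (≤-reflexive (sym j≡1+i))
Succ-asym (s≤s (s≤s (s≤s _))) (inj₁ j≡1+i) (inj₂ (j≡n-1 , i≡0))
  with () ← suc-injective (trans (sym j≡n-1) (trans j≡1+i (cong suc i≡0)))
Succ-asym (s≤s (s≤s (s≤s _))) (inj₂ (i≡n-1 , j≡0)) (inj₁ i≡1+j)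
  with () ← suc-injective (trans (sym i≡n-1) (trans i≡1+j (cong suc j≡0)))
Succ-asym (s≤s (s≤s (s≤s _))) (inj₂ (i≡n-1 , _)) (inj₂ (_ , i≡0))
  with () ← trans (sym i≡n-1) i≡0

Succ-after : (i : Fin (suc n)) → ∃[ j ] Succ (suc n) i j
Succ-after i with view i
... | ‵fromℕ     = fzero , inj₂ (toℕ-fromℕ _ , refl)
... | ‵inject₁ j = fsuc j , inj₁ (cong suc (sym (toℕ-inject₁ j)))

Succ-before : (i : Fin n) → Succ (suc n) (inject₁ i) (fsuc i)
Succ-before i = inj₁ (cong suc (sym (toℕ-inject₁ i)))

CycleAdj-odd⇒even : ∀ {i j : Fin n} → CycleAdj n i j → odd (toℕ i) ≡ true → Even j
CycleAdj-odd⇒even {i = i} (inj₁ (inj₁ j≡1+i)) i-odd =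
  trans (cong odd j≡1+i) (trans (odd-suc (toℕ i)) (cong not i-odd))
CycleAdj-odd⇒even (inj₁ (inj₂ (_ , j≡0))) _ = cong odd j≡0
CycleAdj-odd⇒even {j = j} (inj₂ (inj₁ i≡1+j)) i-odd =
  not-injective (trans (sym (odd-suc (toℕ j))) (trans (cong odd (sym i≡1+j)) i-odd))
CycleAdj-odd⇒even (inj₂ (inj₂ (_ , i≡0))) i-odd with () ← trans (sym i-odd) (cong odd i≡0)

-- Both cycle-neighbours of an odd vertex are even (also across the wrap-around n-1 ~ 0),
-- and for n ≥ 3 they are distinct, so one of them differs from the given even neighbour.
Cycle-even-fort : 3 ≤ n → IsFort (Cycle n) Even
Cycle-even-fort {n = suc n} 3≤n {fzero} _ 0-odd with () ← 0-odd refl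
Cycle-even-fort {n = suc n} 3≤n {fsuc i} {c} _ i-odd _ with Succ-after (fsuc i)
... | s , after with inject₁ i ≟ᶠ c
...   | no p≢c   =
  inject₁ i , inj₂ (Succ-before i) , p≢c , CycleAdj-odd⇒even (inj₂ (Succ-before i)) (¬-not i-odd)
...   | yes refl = s , inj₁ after , s≢p , CycleAdj-odd⇒even (inj₁ after) (¬-not i-odd)
  where
    s≢p : s ≢ inject₁ i
    s≢p refl = Succ-asym 3≤n after (Succ-before i)

Cycle-even-other : 3 ≤ n → ∀ {c : Fin n} → Even c → ∃[ c′ ] Even c′ × c′ ≢ c
Cycle-even-other (s≤s (s≤s (s≤s _))) {c} _ with c ≟ᶠ fzero
... | yes refl = fsuc (fsuc fzero) , refl , λ ()
... | no c≢0   = fzero , refl , c≢0 ∘ sym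

count : (Fin n → Bool) → ℕ
count {n} P = sum (map (λ j → if P j then 1 else 0) (allFin n))

sum-allFin-suc : (f : Fin (suc n) → ℕ) →
                 sum (map f (allFin (suc n))) ≡ f fzero + sum (map (f ∘ fsuc) (allFin n))
sum-allFin-suc {n} f = cong (λ xs → f fzero + sum xs)
  (trans (map-tabulate fsuc f) (sym (map-tabulate (λ j → j) (f ∘ fsuc))))

sum-allFin-const : {f : Fin m → ℕ} → (∀ i → f i ≡ k) → sum (map f (allFin m)) ≡ m * k
sum-allFin-const {zero}  _    = refl
sum-allFin-const {suc m} {f = f} f≡k = begin
  sum (map f (allFin (suc m)))                  ≡⟨ sum-allFin-suc f ⟩
  f fzero + sum (map (f ∘ fsuc) (allFin m))     ≡⟨ cong₂ _+_ (f≡k fzero) (sum-allFin-const (f≡k ∘ fsuc)) ⟩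
  _                                             ∎
  where open ≡-Reasoning

count-odd : count {n} (odd ∘ toℕ) ≡ ⌊ n /2⌋
count-odd {zero}        = refl
count-odd {suc zero}    = refl
count-odd {suc (suc n)} =
  trans (sum-allFin-suc indicator) (trans (sum-allFin-suc (indicator ∘ fsuc)) (cong suc (count-odd {n})))
  where
    indicator : Fin (suc (suc n)) → ℕ
    indicator j = if odd (toℕ j) then 1 else 0

⌊n/2⌋≡n/2 : ∀ n → ⌊ n /2⌋ ≡ n / 2
⌊n/2⌋≡n/2 zero          = refl
⌊n/2⌋≡n/2 (suc zero)    = refl
⌊n/2⌋≡n/2 (suc (suc n)) =
  trans (cong suc (⌊n/2⌋≡n/2 n)) (sym (m/n≡1+[m∸n]/n {suc (suc n)} {2} (s≤s (s≤s z≤n))))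

oddInFirstRow : Fin m × Fin n → Bool
oddInFirstRow (fzero  , j) = odd (toℕ j)
oddInFirstRow (fsuc _ , _) = true

card-oddInFirstRow : ∀ m n → card (suc m) n oddInFirstRow ≡ m * n + n / 2
card-oddInFirstRow m n = begin
  card (suc m) n oddInFirstRow                   ≡⟨ sum-allFin-suc row ⟩
  row fzero + sum (map (row ∘ fsuc) (allFin m))  ≡⟨ cong₂ _+_ (count-odd {n}) (sum-allFin-const full-row) ⟩
  ⌊ n /2⌋ + m * n                                ≡⟨ cong (_+ m * n) (⌊n/2⌋≡n/2 n) ⟩
  n / 2 + m * n                                  ≡⟨ +-comm (n / 2) (m * n) ⟩
  m * n + n / 2                                  ∎
  where
    open ≡-Reasoning
    row : Fin (suc m) → ℕ
    row i = count {n} (λ j → oddInFirstRow {suc m} (i , j))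

    full-row : ∀ i → row (fsuc i) ≡ n
    full-row _ = trans (sum-allFin-const {n} (λ _ → refl)) (*-identityʳ n)

corollary3p15 : (m n : ℕ) → 3 ≤ m → 3 ≤ n →
    Σ (Fin m × Fin n → Bool) (λ S →
      FailedZeroForcingSet (Lex (Cycle m) (Cycle n)) S
      × n * m ∸ n + n / 2 ≤ card m n S)
corollary3p15 (suc m) n@(suc _) _ 3≤n = oddInFirstRow , failed , ≤-reflexive size
  where
    W : Fin (suc m) × Fin n → Set
    W v = proj₁ v ≡ fzero × Even (proj₂ v)

    fort : IsFort (Lex (Cycle (suc m)) (Cycle n)) W
    fort = Lex-fort {G = Cycle (suc m)} {H = Cycle n} {T = Even} fzero
             (Cycle-even-fort 3≤n) (Cycle-even-other 3≤n)

    disjoint : ∀ {v} → oddInFirstRow v ≡ true → ¬ W v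
    disjoint first-row-odd (refl , even) with () ← trans (sym first-row-odd) even

    failed : FailedZeroForcingSet (Lex (Cycle (suc m)) (Cycle n)) oddInFirstRow
    failed = fort⇒failed fort disjoint {fzero , fzero} (refl , refl)

    size : n * suc m ∸ n + n / 2 ≡ card (suc m) n oddInFirstRow
    size = begin
      n * suc m ∸ n + n / 2    ≡⟨ cong (λ x → x ∸ n + n / 2) (*-suc n m) ⟩
      n + n * m ∸ n + n / 2    ≡⟨ cong (_+ n / 2) (trans (m+n∸m≡n n (n * m)) (*-comm n m)) ⟩
      m * n + n / 2            ≡⟨ sym (card-oddInFirstRow m n) ⟩
      card (suc m) n oddInFirstRow ∎
      where open ≡-Reasoning
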